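{- Let $R$ be a tolerance on $U$ induced by an irredundant covering of $U$. Then $(\wp(U)^{\uparrow},\supseteq)$ is order-isomorphic to $(S^*(\mathit{RS}),\le)$, and $(\wp(U)^{\downarrow},\supseteq)$ is order-isomorphic to $(S^+(\mathit{RS}),\le)$.
   Context: A tolerance on $U$ is a reflexive symmetric relation; $R(x)=\{y\mid x\,R\,y\}$; $X^{\downarrow}=\{x\mid R(x)\subseteq X\}$, $X^{\uparrow}=\{x\mid R(x)\cap X\neq\emptyset\}$. A covering is a family of nonempty subsets of $U$ with union $U$, irredundant if no member can be removed keeping a covering; its induced tolerance is $\bigcup\{X\times X\mid X\in\mathcal{H}\}$. $\wp(U)^{\downarrow}=\{X^{\downarrow}\mid X\subseteq U\}$, $\wp(U)^{\uparrow}=\{X^{\uparrow}\mid X\subseteq U\}$. $\mathit{RS}=\{(X^{\downarrow},X^{\uparrow})\mid X\subseteq U\}$ with the coordinatewise order, which for such $R$ is a complete distributive lattice with pseudocomplement $a^*$ ($a\wedge z=(\emptyset,\emptyset)\iff z\le a^*$) and dual pseudocomplement $a^+$ ($a\vee z=(U,U)\iff z\ge a^+$). $S^*(\mathit{RS})=\{a^*\mid a\in\mathit{RS}\}$ and $S^+(\mathit{RS})=\{a^+\mid a\in\mathit{RS}\}$. -}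

module Defs where

open import Level using (Level; 0ℓ; Setω) renaming (suc to lsuc)
open import Data.Product using (Σ; ∃; ∃-syntax; _×_; _,_; proj₁; proj₂)
open import Relation.Nullary using (¬_)
open import Function.Bundles using (_⇔_)
open import Axiom.ExcludedMiddle using (ExcludedMiddle)

Sub : Set → Set₁
Sub U = U → Set

module _ {U : Set} where

  _⊆_ : Sub U → Sub U → Set
  X ⊆ Y = ∀ x → X x → Y x

  _≐_ : Sub U → Sub U → Set
  X ≐ Y = (X ⊆ Y) × (Y ⊆ X)

  record IsCovering {I : Set} (H : I → Sub U) : Set where
    field
      nonempty : ∀ i → ∃[ x ] H i x
      covers   : ∀ x → ∃[ i ] H i x

  -- irredundant: no member H i can be removed (i.e. the members that are
  -- different from H i as sets) while still covering U
  Irredundant : {I : Set} → (H : I → Sub U) → Set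
  Irredundant {I} H = ∀ i → ¬ (∀ x → ∃[ j ] (¬ (H j ≐ H i) × H j x))

  induced : {I : Set} → (I → Sub U) → U → U → Set
  induced {I} H x y = ∃[ i ] (H i x × H i y)

  module Approx (R : U → U → Set) where

    _↓ : Sub U → Sub U
    (X ↓) x = ∀ y → R x y → X y

    _↑ : Sub U → Sub U
    (X ↑) x = ∃[ y ] (R x y × X y)

    InLowerImages : Sub U → Set₁
    InLowerImages Y = ∃[ X ] (Y ≐ (X ↓))

    InUpperImages : Sub U → Set₁
    InUpperImages Y = ∃[ X ] (Y ≐ (X ↑))

    ℘↓ : Set₁
    ℘↓ = Σ (Sub U) InLowerImages

    ℘↑ : Set₁
    ℘↑ = Σ (Sub U) InUpperImages

    _⊇↓_ : ℘↓ → ℘↓ → Set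
    A ⊇↓ B = proj₁ B ⊆ proj₁ A

    _⊇↑_ : ℘↑ → ℘↑ → Set
    A ⊇↑ B = proj₁ B ⊆ proj₁ A

    Pair : Set₁
    Pair = Sub U × Sub U

    InRS : Pair → Set₁
    InRS (A , B) = ∃[ X ] ((A ≐ (X ↓)) × (B ≐ (X ↑)))

    _≤_ : Pair → Pair → Set
    (A , B) ≤ (C , D) = (A ⊆ C) × (B ⊆ D)

    ⊥RS : Pair
    ⊥RS = (λ _ → Data.Empty.⊥) , (λ _ → Data.Empty.⊥)
      where import Data.Empty

    ⊤RS : Pair
    ⊤RS = (λ _ → Data.Unit.⊤) , (λ _ → Data.Unit.⊤)
      where import Data.Unit

    -- a ∧ z = (∅,∅) in RS: every common lower bound in RS is (∅,∅)
    -- (RS is a lattice, so this says exactly that the meet is the bottom)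
    MeetIsBot : Pair → Pair → Set₁
    MeetIsBot a z = ∀ w → InRS w → w ≤ a → w ≤ z → w ≤ ⊥RS

    -- a ∨ z = (U,U) in RS: every common upper bound in RS is (U,U)
    JoinIsTop : Pair → Pair → Set₁
    JoinIsTop a z = ∀ w → InRS w → a ≤ w → z ≤ w → ⊤RS ≤ w

    IsPseudocomplement : Pair → Pair → Set₁
    IsPseudocomplement a c =
      InRS c × (∀ z → InRS z → (MeetIsBot a z ⇔ (z ≤ c)))

    IsDualPseudocomplement : Pair → Pair → Set₁
    IsDualPseudocomplement a c =
      InRS c × (∀ z → InRS z → (JoinIsTop a z ⇔ (c ≤ z)))

    S* : Set₁
    S* = Σ Pair λ c → ∃[ a ] (InRS a × IsPseudocomplement a c)

    S⁺ : Set₁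
    S⁺ = Σ Pair λ c → ∃[ a ] (InRS a × IsDualPseudocomplement a c)

    _≤*_ : S* → S* → Set
    a ≤* b = proj₁ a ≤ proj₁ b

    _≤⁺_ : S⁺ → S⁺ → Set
    a ≤⁺ b = proj₁ a ≤ proj₁ b

-- In both posets used here equality is antisymmetry of the order
-- (extensional equality of subsets), so an order isomorphism is a map
-- that preserves and reflects the order and is surjective up to that
-- equality (injectivity then follows from order reflection).

record OrderIso {A B : Set₁} (_≤A_ : A → A → Set) (_≤B_ : B → B → Set) : Set₁ where
  field
    to        : A → B
    mono⇔     : ∀ a a′ → (a ≤A a′) ⇔ (to a ≤B to a′)
    surjective : ∀ b → ∃[ a ] ((to a ≤B b) × (b ≤B to a))

-- classical logic (the paper's ambient metatheory)
Classical : Setω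
Classical = ∀ {ℓ} → ExcludedMiddle ℓ

-- Irredundancy gives every block H i a core point c, lying in no other
-- block, so R(c) = H i. The pair ⟦{c}⟧ = ({c}↓, {c}↑) is a nonzero element
-- of RS below (X↓, X↑) whenever H i meets X, and ⟦∁{c}⟧ is a non-top
-- element above (X↓, X↑) whenever H i ⊈ X.
-- Testing against these shows (X↓, X↑)* = ((∁ X↑)↓, (∁ X↑)↑) and
-- (X↓, X↑)⁺ = ((∁ X↓)↓, (∁ X↓)↑), so A ↦ ((∁ A)↓, (∁ A)↑) maps ℘(U)↑ onto
-- S*(RS) and ℘(U)↓ onto S⁺(RS). The map is antitone, and it reflects the
-- order because A = (A↓)↑ on ℘(U)↑ and B = (B↑)↓ on ℘(U)↓ while
-- (∁ A)↑ = ∁ (A↓) and (∁ B)↓ = ∁ (B↑).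
module Submission where

open import Defs
open import Data.Product using (_×_)

open import Data.Product using (∃-syntax; _,_; proj₁; proj₂)
open import Data.Sum using (_⊎_; inj₁; inj₂)
open import Data.Empty using (⊥-elim)
open import Data.Unit using (tt)
open import Relation.Nullary using (¬_; yes; no)
open import Relation.Unary using (∁; ｛_｝)
open import Relation.Binary.Definitions using (Reflexive; Symmetric)
open import Relation.Binary.PropositionalEquality using (refl)
open import Function.Bundles using (mk⇔; Equivalence)
open import Axiom.DoubleNegationElimination using (em⇒dne)

module Approximations {U : Set} (R : U → U → Set) where

  open Approx R public

  ⊆-refl : {X : Sub U} → X ⊆ X
  ⊆-refl _ Xx = Xx

  ⊆-trans : {X Y Z : Sub U} → X ⊆ Y → Y ⊆ Z → X ⊆ Z
  ⊆-trans X⊆Y Y⊆Z x Xx = Y⊆Z x (X⊆Y x Xx)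

  ≐-refl : {X : Sub U} → X ≐ X
  ≐-refl = ⊆-refl , ⊆-refl

  ≤-refl : {a : Pair} → a ≤ a
  ≤-refl = ⊆-refl , ⊆-refl

  ≤-trans : {a b c : Pair} → a ≤ b → b ≤ c → a ≤ c
  ≤-trans (A⊆C , B⊆D) (C⊆E , D⊆F) = ⊆-trans A⊆C C⊆E , ⊆-trans B⊆D D⊆F

  ↓-mono : {X Y : Sub U} → X ⊆ Y → (X ↓) ⊆ (Y ↓)
  ↓-mono X⊆Y x Rx⊆X y Rxy = X⊆Y y (Rx⊆X y Rxy)

  ↑-mono : {X Y : Sub U} → X ⊆ Y → (X ↑) ⊆ (Y ↑)
  ↑-mono X⊆Y x (y , Rxy , Xy) = y , Rxy , X⊆Y y Xy

  ∁↑⇒¬↓ : {X : Sub U} {x : U} → (∁ X ↑) x → ¬ (X ↓) x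
  ∁↑⇒¬↓ (y , Rxy , ¬Xy) X↓x = ¬Xy (X↓x y Rxy)

  ∁↓⇒¬↑ : {X : Sub U} {x : U} → (∁ X ↓) x → ¬ (X ↑) x
  ∁↓⇒¬↑ ∁X↓x (y , Rxy , Xy) = ∁X↓x y Rxy Xy

  ¬↑⇒∁↓ : {X : Sub U} {x : U} → ¬ (X ↑) x → (∁ X ↓) x
  ¬↑⇒∁↓ ¬X↑x y Rxy Xy = ¬X↑x (y , Rxy , Xy)

  ⟦_⟧ : Sub U → Pair
  ⟦ X ⟧ = (X ↓) , (X ↑)

  ⟦⟧∈RS : (X : Sub U) → InRS ⟦ X ⟧
  ⟦⟧∈RS X = X , ≐-refl , ≐-refl

  ⟦⟧-mono : {X Y : Sub U} → X ⊆ Y → ⟦ X ⟧ ≤ ⟦ Y ⟧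
  ⟦⟧-mono X⊆Y = ↓-mono X⊆Y , ↑-mono X⊆Y

  ⟦∁⟧-antitone : {X Y : Sub U} → X ⊆ Y → ⟦ ∁ Y ⟧ ≤ ⟦ ∁ X ⟧
  ⟦∁⟧-antitone X⊆Y = ⟦⟧-mono λ x ¬Yx Xx → ¬Yx (X⊆Y x Xx)

  module _ {P Q X : Sub U} (P≐X↓ : P ≐ (X ↓)) (Q≐X↑ : Q ≐ (X ↑)) where

    ≐⇒≤⟦⟧ : (P , Q) ≤ ⟦ X ⟧
    ≐⇒≤⟦⟧ = proj₁ P≐X↓ , proj₁ Q≐X↑

    ≐⇒⟦⟧≤ : ⟦ X ⟧ ≤ (P , Q)
    ≐⇒⟦⟧≤ = proj₂ P≐X↓ , proj₂ Q≐X↑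

  pseudocomplement-unique : {a c c′ : Pair} →
    IsPseudocomplement a c → IsPseudocomplement a c′ → c′ ≤ c
  pseudocomplement-unique (_ , c-spec) (c′∈RS , c′-spec) =
    Equivalence.to (c-spec _ c′∈RS) (Equivalence.from (c′-spec _ c′∈RS) ≤-refl)

  dual-pseudocomplement-unique : {a c c′ : Pair} →
    IsDualPseudocomplement a c → IsDualPseudocomplement a c′ → c ≤ c′
  dual-pseudocomplement-unique (_ , c-spec) (c′∈RS , c′-spec) =
    Equivalence.to (c-spec _ c′∈RS) (Equivalence.from (c′-spec _ c′∈RS) ≤-refl)

  module _ (R-refl : Reflexive R) where

    ⟦｛x｝⟧≰⊥ : {x : U} → ¬ (⟦ ｛ x ｝ ⟧ ≤ ⊥RS)
    ⟦｛x｝⟧≰⊥ {x} (_ , ↑⊆∅) = ↑⊆∅ x (x , R-refl , refl)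

    ⊤≰⟦∁｛x｝⟧ : {x : U} → ¬ (⊤RS ≤ ⟦ ∁ ｛ x ｝ ⟧)
    ⊤≰⟦∁｛x｝⟧ {x} (U⊆↓ , _) = U⊆↓ x tt x R-refl refl

    ⟦⟧≤⊥ : {W : Sub U} → (∀ x → ¬ W x) → ⟦ W ⟧ ≤ ⊥RS
    ⟦⟧≤⊥ W-empty = (λ x W↓x → W-empty x (W↓x x R-refl))
                 , (λ { x (y , _ , Wy) → W-empty y Wy })

    ⊤≤⟦⟧ : {W : Sub U} → (∀ x → W x) → ⊤RS ≤ ⟦ W ⟧
    ⊤≤⟦⟧ W-full = (λ _ _ y _ → W-full y) , (λ x _ → x , R-refl , W-full x)

    ｛x｝↓⊆↓ : {S : Sub U} {x : U} → (S ↑) x → (｛ x ｝ ↓) ⊆ (S ↓)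
    ｛x｝↓⊆↓ (s , Rxs , Ss) v Rv⊆｛x｝ y Rvy with Rv⊆｛x｝ v R-refl
    ... | refl with Rv⊆｛x｝ s Rxs | Rv⊆｛x｝ y Rvy
    ... | refl | refl = Ss

  module _ (R-sym : Symmetric R) where

    ⊆↑↓ : {X : Sub U} → X ⊆ ((X ↑) ↓)
    ⊆↑↓ x Xx y Rxy = x , R-sym Rxy , Xx

    ↓↑⊆ : {X : Sub U} → ((X ↓) ↑) ⊆ X
    ↓↑⊆ x (y , Rxy , X↓y) = X↓y x (R-sym Rxy)

module ClassicalApproximations (em : Classical) {U : Set} (R : U → U → Set) where

  open Approximations R

  private
    dne : {P : Set} → ¬ ¬ P → P
    dne = em⇒dne em

  ¬↓⇒∁↑ : {X : Sub U} {x : U} → ¬ (X ↓) x → (∁ X ↑) x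
  ¬↓⇒∁↑ ¬X↓x = dne λ ¬∁X↑x → ¬X↓x λ y Rxy → dne λ ¬Xy → ¬∁X↑x (y , Rxy , ¬Xy)

  ↑⊆∁｛x｝↑ : Reflexive R → {S : Sub U} {x : U} → ¬ (S ↓) x → (S ↑) ⊆ (∁ ｛ x ｝ ↑)
  ↑⊆∁｛x｝↑ R-refl {S} {x} ¬S↓x v S↑v = ¬↓⇒∁↑ v∉｛x｝↓
    where
    v∉｛x｝↓ : ¬ (｛ x ｝ ↓) v
    v∉｛x｝↓ Rv⊆｛x｝ with Rv⊆｛x｝ v R-refl
    ... | refl = ¬S↓x (｛x｝↓⊆↓ R-refl S↑v x Rv⊆｛x｝)

  module _ (R-sym : Symmetric R) where

    upper-reflect : {A A′ : Sub U} → InUpperImages A′ → (∁ A ↑) ⊆ (∁ A′ ↑) → A′ ⊆ A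
    upper-reflect {A} {A′} (Y , A′≐Y↑) ∁A↑⊆∁A′↑ =
      ⊆-trans A′⊆A′↓↑ (⊆-trans (↑-mono A′↓⊆A↓) (↓↑⊆ R-sym))
      where
      A′⊆A′↓↑ : A′ ⊆ ((A′ ↓) ↑)
      A′⊆A′↓↑ = ⊆-trans (proj₁ A′≐Y↑) (↑-mono (⊆-trans (⊆↑↓ R-sym) (↓-mono (proj₂ A′≐Y↑))))

      A′↓⊆A↓ : (A′ ↓) ⊆ (A ↓)
      A′↓⊆A↓ x A′↓x = dne λ ¬A↓x → ∁↑⇒¬↓ (∁A↑⊆∁A′↑ x (¬↓⇒∁↑ ¬A↓x)) A′↓x

    lower-reflect : {B B′ : Sub U} → InLowerImages B → (∁ B ↓) ⊆ (∁ B′ ↓) → B′ ⊆ B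
    lower-reflect {B} {B′} (Y , B≐Y↓) ∁B↓⊆∁B′↓ =
      ⊆-trans (⊆↑↓ R-sym) (⊆-trans (↓-mono B′↑⊆B↑) B↑↓⊆B)
      where
      B′↑⊆B↑ : (B′ ↑) ⊆ (B ↑)
      B′↑⊆B↑ x B′↑x = dne λ ¬B↑x → ∁↓⇒¬↑ (∁B↓⊆∁B′↓ x (¬↑⇒∁↓ ¬B↑x)) B′↑x

      B↑↓⊆B : ((B ↑) ↓) ⊆ B
      B↑↓⊆B = ⊆-trans (↓-mono (⊆-trans (↑-mono (proj₁ B≐Y↓)) (↓↑⊆ R-sym))) (proj₂ B≐Y↓)

module IrredundantCovering (em : Classical) {U I : Set} (H : I → Sub U)
                           (covering : IsCovering H) (irredundant : Irredundant H) where

  open IsCovering covering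
  open Approximations (induced H)
  open ClassicalApproximations em (induced H)

  private
    dne : {P : Set} → ¬ ¬ P → P
    dne = em⇒dne em

  induced-refl : Reflexive (induced H)
  induced-refl {x} = let (i , Hix) = covers x in i , Hix , Hix

  induced-sym : Symmetric (induced H)
  induced-sym (i , Hix , Hiy) = i , Hiy , Hix

  private
    core-exists : ∀ i → ∃[ x ] (∀ j → H j x → H j ≐ H i)
    core-exists i = dne λ ¬core → irredundant i λ x →
      dne λ ¬elsewhere → ¬core (x , λ j Hjx → dne λ Hj≉Hi → ¬elsewhere (j , Hj≉Hi , Hjx))

  core : I → U
  core i = proj₁ (core-exists i)

  core-block≐ : ∀ {i j} → H j (core i) → H j ≐ H i
  core-block≐ {i} {j} = proj₂ (core-exists i) j

  core∈ : ∀ i → H i (core i)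
  core∈ i = let (j , Hj-core) = covers (core i) in proj₁ (core-block≐ Hj-core) _ Hj-core

  R-core⇒H : ∀ {i y} → induced H (core i) y → H i y
  R-core⇒H (j , Hj-core , Hjy) = proj₁ (core-block≐ Hj-core) _ Hjy

  H⇒R-core : ∀ {i y} → H i y → induced H (core i) y
  H⇒R-core {i} Hiy = i , core∈ i , Hiy

  ↑-core⇒block : ∀ {X i u} → (X ↑) (core i) → H i u → (X ↑) u
  ↑-core⇒block {i = i} (s , R-core-s , Xs) Hiu = s , (i , Hiu , R-core⇒H R-core-s) , Xs

  ↓-block⇒core : ∀ {X i u} → H i u → (X ↓) u → (X ↓) (core i)
  ↓-block⇒core {i = i} Hiu X↓u y R-core-y = X↓u y (i , Hiu , R-core⇒H R-core-y)

  ⟦｛core｝⟧≤ : ∀ {X i} → (X ↑) (core i) → ⟦ ｛ core i ｝ ⟧ ≤ ⟦ X ⟧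
  ⟦｛core｝⟧≤ X↑core = ｛x｝↓⊆↓ induced-refl X↑core
                     , λ { v (_ , Rv-core , refl) → ↑-core⇒block X↑core (R-core⇒H (induced-sym Rv-core)) }

  ≤⟦∁｛core｝⟧ : ∀ {X i} → ¬ (X ↓) (core i) → ⟦ X ⟧ ≤ ⟦ ∁ ｛ core i ｝ ⟧
  ≤⟦∁｛core｝⟧ ¬X↓core =
      (λ { v X↓v _ Rv-core refl → ¬X↓core (↓-block⇒core (R-core⇒H (induced-sym Rv-core)) X↓v) })
    , ↑⊆∁｛x｝↑ induced-refl ¬X↓core

  pseudocomplement : ∀ {A X P Q} → A ≐ (X ↑) → P ≐ (X ↓) → Q ≐ (X ↑) →
                     IsPseudocomplement (P , Q) ⟦ ∁ A ⟧
  pseudocomplement {A} {X} {P} {Q} A≐X↑ P≐X↓ Q≐X↑ =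
    ⟦⟧∈RS (∁ A) , λ { _ (_ , P′≐Y↓ , Q′≐Y↑) →
      mk⇔ (meet⇒≤ (≐⇒≤⟦⟧ P′≐Y↓ Q′≐Y↑) (≐⇒⟦⟧≤ P′≐Y↓ Q′≐Y↑)) ≤⇒meet }
    where
    disjoint : ∀ {z Y} → ⟦ Y ⟧ ≤ z → MeetIsBot (P , Q) z → Y ⊆ ∁ A
    disjoint ⟦Y⟧≤z meet y Yy Ay with proj₁ A≐X↑ y Ay
    ... | s , (j , Hjy , Hjs) , Xs =
      ⟦｛x｝⟧≰⊥ induced-refl (meet ⟦ ｛ core j ｝ ⟧ (⟦⟧∈RS _)
        (≤-trans (⟦｛core｝⟧≤ (s , H⇒R-core Hjs , Xs)) (≐⇒⟦⟧≤ P≐X↓ Q≐X↑))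
        (≤-trans (⟦｛core｝⟧≤ (y , H⇒R-core Hjy , Yy)) ⟦Y⟧≤z))

    meet⇒≤ : ∀ {z Y} → z ≤ ⟦ Y ⟧ → ⟦ Y ⟧ ≤ z → MeetIsBot (P , Q) z → z ≤ ⟦ ∁ A ⟧
    meet⇒≤ z≤⟦Y⟧ ⟦Y⟧≤z meet = ≤-trans z≤⟦Y⟧ (⟦⟧-mono (disjoint ⟦Y⟧≤z meet))

    ≤⇒meet : ∀ {z} → z ≤ ⟦ ∁ A ⟧ → MeetIsBot (P , Q) z
    ≤⇒meet z≤⟦∁A⟧ w (W , P″≐W↓ , Q″≐W↑) w≤a w≤z =
      ≤-trans (≐⇒≤⟦⟧ P″≐W↓ Q″≐W↑) (⟦⟧≤⊥ induced-refl W-empty)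
      where
      W-empty : ∀ u → ¬ W u
      W-empty u Wu =
        let (j , Hju)      = covers u
            W↑core         = proj₂ (≐⇒⟦⟧≤ P″≐W↓ Q″≐W↑) _ (u , H⇒R-core Hju , Wu)
            X↑core         = proj₁ Q≐X↑ _ (proj₂ w≤a _ W↑core)
            (t , Rt , ¬At) = proj₂ z≤⟦∁A⟧ _ (proj₂ w≤z _ W↑core)
        in ¬At (proj₂ A≐X↑ t (↑-core⇒block X↑core (R-core⇒H Rt)))

  dual-pseudocomplement : ∀ {B X P Q} → B ≐ (X ↓) → P ≐ (X ↓) → Q ≐ (X ↑) →
                          IsDualPseudocomplement (P , Q) ⟦ ∁ B ⟧
  dual-pseudocomplement {B} {X} {P} {Q} B≐X↓ P≐X↓ Q≐X↑ =
    ⟦⟧∈RS (∁ B) , λ { _ (_ , P′≐Y↓ , Q′≐Y↑) →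
      mk⇔ (join⇒≤ (≐⇒≤⟦⟧ P′≐Y↓ Q′≐Y↑) (≐⇒⟦⟧≤ P′≐Y↓ Q′≐Y↑)) ≤⇒join }
    where
    block-inside : ∀ {z Y} → z ≤ ⟦ Y ⟧ → JoinIsTop (P , Q) z → ∀ j → (X ↓) (core j) ⊎ (Y ↓) (core j)
    block-inside {Y = Y} z≤⟦Y⟧ join j with em {P = (X ↓) (core j)} | em {P = (Y ↓) (core j)}
    ... | yes X↓core | _ = inj₁ X↓core
    ... | no _ | yes Y↓core = inj₂ Y↓core
    ... | no ¬X↓core | no ¬Y↓core =
      ⊥-elim (⊤≰⟦∁｛x｝⟧ induced-refl (join ⟦ ∁ ｛ core j ｝ ⟧ (⟦⟧∈RS _)
        (≤-trans (≐⇒≤⟦⟧ P≐X↓ Q≐X↑) (≤⟦∁｛core｝⟧ ¬X↓core))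
        (≤-trans z≤⟦Y⟧ (≤⟦∁｛core｝⟧ ¬Y↓core))))

    covering-complement : ∀ {z Y} → z ≤ ⟦ Y ⟧ → JoinIsTop (P , Q) z → ∁ B ⊆ Y
    covering-complement z≤⟦Y⟧ join u ¬Bu with ¬↓⇒∁↑ (λ X↓u → ¬Bu (proj₂ B≐X↓ u X↓u))
    ... | w , (j , Hju , Hjw) , ¬Xw with block-inside z≤⟦Y⟧ join j
    ... | inj₁ X↓core = ⊥-elim (¬Xw (X↓core w (H⇒R-core Hjw)))
    ... | inj₂ Y↓core = Y↓core u (H⇒R-core Hju)

    join⇒≤ : ∀ {z Y} → z ≤ ⟦ Y ⟧ → ⟦ Y ⟧ ≤ z → JoinIsTop (P , Q) z → ⟦ ∁ B ⟧ ≤ z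
    join⇒≤ z≤⟦Y⟧ ⟦Y⟧≤z join = ≤-trans (⟦⟧-mono (covering-complement z≤⟦Y⟧ join)) ⟦Y⟧≤z

    ≤⇒join : ∀ {z} → ⟦ ∁ B ⟧ ≤ z → JoinIsTop (P , Q) z
    ≤⇒join ⟦∁B⟧≤z w (W , P″≐W↓ , Q″≐W↑) a≤w z≤w =
      ≤-trans (⊤≤⟦⟧ induced-refl W-full) (≐⇒⟦⟧≤ P″≐W↓ Q″≐W↑)
      where
      w≤⟦W⟧ : w ≤ ⟦ W ⟧
      w≤⟦W⟧ = ≐⇒≤⟦⟧ P″≐W↓ Q″≐W↑

      W↓core : ∀ j → (W ↓) (core j)
      W↓core j with em {P = (X ↓) (core j)}
      ... | yes X↓core = proj₁ (≤-trans (≐⇒⟦⟧≤ P≐X↓ Q≐X↑) (≤-trans a≤w w≤⟦W⟧)) _ X↓core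
      ... | no ¬X↓core = proj₁ (≤-trans ⟦∁B⟧≤z (≤-trans z≤w w≤⟦W⟧)) _ ∁B↓core
        where
        ∁B↓core : (∁ B ↓) (core j)
        ∁B↓core u R-core-u Bu = ¬X↓core (↓-block⇒core (R-core⇒H R-core-u) (proj₁ B≐X↓ u Bu))

      W-full : ∀ v → W v
      W-full v = let (j , Hjv) = covers v in W↓core j v (H⇒R-core Hjv)

  upper-iso : OrderIso _⊇↑_ _≤*_
  upper-iso = record
    { to         = to
    ; mono⇔      = λ { (A , _) (A′ , A′∈℘↑) →
                     mk⇔ ⟦∁⟧-antitone (λ ⟦∁A⟧≤⟦∁A′⟧ → upper-reflect induced-sym A′∈℘↑ (proj₂ ⟦∁A⟧≤⟦∁A′⟧)) }
    ; surjective = λ { (c , (P , Q) , (X , P≐X↓ , Q≐X↑) , c-pc) →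
                     let Q-pc = pseudocomplement Q≐X↑ P≐X↓ Q≐X↑
                     in (Q , X , Q≐X↑) , pseudocomplement-unique c-pc Q-pc
                                       , pseudocomplement-unique Q-pc c-pc }
    }
    where
    to : ℘↑ → S*
    to (A , X , A≐X↑) = ⟦ ∁ A ⟧ , ⟦ X ⟧ , ⟦⟧∈RS X , pseudocomplement A≐X↑ ≐-refl ≐-refl

  lower-iso : OrderIso _⊇↓_ _≤⁺_
  lower-iso = record
    { to         = to
    ; mono⇔      = λ { (B , B∈℘↓) (B′ , _) →
                     mk⇔ ⟦∁⟧-antitone (λ ⟦∁B⟧≤⟦∁B′⟧ → lower-reflect induced-sym B∈℘↓ (proj₁ ⟦∁B⟧≤⟦∁B′⟧)) }
    ; surjective = λ { (c , (P , Q) , (X , P≐X↓ , Q≐X↑) , c-dpc) →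
                     let P-dpc = dual-pseudocomplement P≐X↓ P≐X↓ Q≐X↑
                     in (P , X , P≐X↓) , dual-pseudocomplement-unique P-dpc c-dpc
                                       , dual-pseudocomplement-unique c-dpc P-dpc }
    }
    where
    to : ℘↓ → S⁺
    to (B , X , B≐X↓) = ⟦ ∁ B ⟧ , ⟦ X ⟧ , ⟦⟧∈RS X , dual-pseudocomplement B≐X↓ ≐-refl ≐-refl

lemma3p5 : Classical →
    (U : Set) (I : Set) (H : I → Sub U) →
    IsCovering H → Irredundant H →
    let open Approx (induced H) in
    OrderIso _⊇↑_ _≤*_ × OrderIso _⊇↓_ _≤⁺_
lemma3p5 em U I H covering irredundant = upper-iso , lower-iso
  where open IrredundantCovering em H covering irredundant
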